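{- Let $L$ be a residuated lattice in which every minimal prime filter is finitely generated, and let $F$ be a filter of $L$. Then $F$ is essential in $L$ if and only if $F\not\subseteq P$ for every minimal prime filter $P$ of $L$.
   Context: A residuated lattice is an algebra $(L,\wedge,\vee,\odot,\rightarrow,0,1)$ such that $(L,\wedge,\vee,0,1)$ is a bounded lattice, $(L,\odot,1)$ is a commutative monoid, and $x\odot z\le y$ iff $z\le x\rightarrow y$. A filter is a nonempty subset closed under $\odot$ and upward closed; it is finitely generated if it is the smallest filter containing some finite set. A proper filter $P$ is prime if $x\vee y\in P$ implies $x\in P$ or $y\in P$; it is minimal prime if no prime filter is strictly contained in it. A filter $H$ is essential in $L$ if for every filter $G$, $H\cap G=\{1\}$ implies $G=\{1\}$. -}

module Defs where

open import Level using (Level; 0ℓ) renaming (suc to lsuc)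
open import Data.Product using (Σ; ∃; _×_; _,_)
open import Data.Sum using (_⊎_)
open import Data.List using (List)
open import Data.List.Membership.Propositional using (_∈_)
open import Relation.Nullary using (¬_)
open import Relation.Unary using (Pred; _⊆_)
open import Relation.Binary.PropositionalEquality using (_≡_)
open import Relation.Binary.Bundles using (Poset)
open import Function.Bundles using (_⇔_)

record ResiduatedLattice : Set₁ where
  infixr 7 _∧_
  infixr 6 _∨_
  infixr 8 _⊙_
  infixr 5 _⇒_
  infix  4 _≤_
  field
    Carrier : Set
    _∧_ _∨_ _⊙_ _⇒_ : Carrier → Carrier → Carrier
    𝟘 𝟙 : Carrier
    ∧-comm   : ∀ x y → x ∧ y ≡ y ∧ x
    ∨-comm   : ∀ x y → x ∨ y ≡ y ∨ x
    ∧-assoc  : ∀ x y z → (x ∧ y) ∧ z ≡ x ∧ (y ∧ z)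
    ∨-assoc  : ∀ x y z → (x ∨ y) ∨ z ≡ x ∨ (y ∨ z)
    ∧-absorbs-∨ : ∀ x y → x ∧ (x ∨ y) ≡ x
    ∨-absorbs-∧ : ∀ x y → x ∨ (x ∧ y) ≡ x
  _≤_ : Carrier → Carrier → Set
  x ≤ y = x ∧ y ≡ x
  field
    𝟘-least    : ∀ x → 𝟘 ≤ x
    𝟙-greatest : ∀ x → x ≤ 𝟙
    ⊙-comm     : ∀ x y → x ⊙ y ≡ y ⊙ x
    ⊙-assoc    : ∀ x y z → (x ⊙ y) ⊙ z ≡ x ⊙ (y ⊙ z)
    ⊙-identityˡ : ∀ x → 𝟙 ⊙ x ≡ x
    residuation : ∀ x y z → (x ⊙ z ≤ y) ⇔ (z ≤ x ⇒ y)

module _ (L : ResiduatedLattice) where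
  open ResiduatedLattice L

  Subset : Set₁
  Subset = Pred Carrier 0ℓ

  record IsFilter (F : Subset) : Set where
    field
      nonempty : ∃ λ x → F x
      ⊙-closed : ∀ {x y} → F x → F y → F (x ⊙ y)
      up-closed : ∀ {x y} → F x → x ≤ y → F y

  FinitelyGenerated : Subset → Set₁
  FinitelyGenerated F =
    Σ (List Carrier) λ xs →
      IsFilter F × (∀ {x} → x ∈ xs → F x) ×
      (∀ (G : Subset) → IsFilter G → (∀ {x} → x ∈ xs → G x) → F ⊆ G)

  record IsPrime (P : Subset) : Set where
    field
      filter : IsFilter P
      proper : ¬ (∀ x → P x)
      prime  : ∀ {x y} → P (x ∨ y) → P x ⊎ P y

  IsMinimalPrime : Subset → Set₁
  IsMinimalPrime P =
    IsPrime P × ¬ (Σ Subset λ Q → IsPrime Q × Q ⊆ P × ¬ (P ⊆ Q))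

  IsEssential : Subset → Set₁
  IsEssential H =
    ∀ (G : Subset) → IsFilter G →
      (∀ x → (H x × G x) ⇔ (x ≡ 𝟙)) → (∀ x → G x ⇔ (x ≡ 𝟙))

-- Zorn's lemma for posets whose carrier is a type of level 1
-- (e.g. families of subsets), used as a classical metatheoretic hypothesis.

ZornsLemma : Set₂
ZornsLemma =
  ∀ (P : Poset (lsuc 0ℓ) 0ℓ 0ℓ) → let open Poset P in
    (∀ (C : Pred Carrier 0ℓ) →
       (∀ {a b} → C a → C b → a ≤ b ⊎ b ≤ a) →
       ∃ λ u → ∀ {a} → C a → a ≤ u) →
    ∃ λ m → ∀ a → m ≤ a → a ≤ m

module Submission where

-- If F ⊆ P for a minimal prime filter P, finite generation makes P generated by a
-- single element a, and minimality of P yields b ∉ P with a ∨ b = 𝟙. The filter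
-- {z | z ∨ a = 𝟙} then contains b ≠ 𝟙 but meets P, hence F, only in 𝟙.
-- Conversely, if F ∩ G = {𝟙} and 𝟙 ≠ g ∈ G, the prime filter theorem and Zorn's
-- lemma give a minimal prime P ∌ g; taking x ∈ F ∖ P, the element x ∨ g lies in
-- F ∩ G, so it is 𝟙 ∈ P, and primeness puts x or g in P.

open import Defs
open import Level using (0ℓ; lift; lower) renaming (suc to lsuc)
open import Axiom.ExcludedMiddle using (ExcludedMiddle)
open import Axiom.DoubleNegationElimination using (em⇒dne)
open import Algebra.Bundles using (CommutativeMonoid)
open import Algebra.Lattice.Bundles using (Lattice)
open import Algebra.Structures.Biased using (IsCommutativeMonoidˡ)
import Algebra.Lattice.Properties.Lattice as LatticeProperties
import Algebra.Properties.CommutativeSemigroup as CommutativeSemigroupProperties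
import Algebra.Properties.Monoid.Mult as MonoidMultiplication
open import Data.Empty using (⊥-elim)
open import Data.List using (List; []; _∷_; foldr)
open import Data.List.Membership.Propositional using (_∈_)
open import Data.List.Relation.Unary.Any using (here; there)
open import Data.Maybe using (Maybe; nothing; just)
open import Data.Nat using (zero; suc; _+_)
open import Data.Product using (Σ; ∃; _×_; _,_; proj₁; proj₂)
import Data.Product as Product
open import Data.Sum using (_⊎_; inj₁; inj₂; [_,_]′)
import Data.Sum as Sum
open import Function using (_∘_; id; flip)
open import Function.Bundles using (_⇔_; mk⇔; Equivalence)
open import Relation.Binary.Definitions using (Reflexive; Transitive)
open import Relation.Binary.PropositionalEquality
  using (_≡_; _≢_; refl; sym; trans; cong; cong₂; subst; subst₂; isEquivalence)
open import Relation.Binary.Lattice.Structures using ()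
  renaming (IsLattice to IsOrderTheoreticLattice)
open import Relation.Nullary using (¬_; Dec; yes; no)
open import Relation.Nullary.Decidable using (True; toWitness; fromWitness; map′; decidable-stable)
open import Relation.Unary using (Pred; _⊆_; _∩_; _≬_; Satisfiable; ｛_｝)

module ResiduatedLatticeProperties (L : ResiduatedLattice) where
  open ResiduatedLattice L
  open Equivalence

  lattice : Lattice 0ℓ 0ℓ
  lattice = record
    { isLattice = record
      { isEquivalence = isEquivalence
      ; ∨-comm = ∨-comm ; ∨-assoc = ∨-assoc ; ∨-cong = cong₂ _∨_
      ; ∧-comm = ∧-comm ; ∧-assoc = ∧-assoc ; ∧-cong = cong₂ _∧_
      ; absorptive = ∨-absorbs-∧ , ∧-absorbs-∨
      }
    }

  ⊙-commutativeMonoid : CommutativeMonoid 0ℓ 0ℓ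
  ⊙-commutativeMonoid = record
    { isCommutativeMonoid = IsCommutativeMonoidˡ.isCommutativeMonoid record
      { isSemigroup = record
        { isMagma = record { isEquivalence = isEquivalence ; ∙-cong = cong₂ _⊙_ }
        ; assoc = ⊙-assoc
        }
      ; identityˡ = ⊙-identityˡ
      ; comm = ⊙-comm
      }
    }

  open LatticeProperties lattice public using (∨-idem)
  open CommutativeMonoid ⊙-commutativeMonoid public
    using (commutativeSemigroup; monoid) renaming (identityʳ to ⊙-identityʳ)
  open CommutativeSemigroupProperties commutativeSemigroup public using (interchange)
  -- n · x is the n-th ⊙-power of x, written n × x in the library's additive notation.
  open MonoidMultiplication monoid public
    using (×-homo-1; ×-homo-+) renaming (_×_ to _·_)

  -- The library orders a lattice by x ≡ x ∧ y, whereas Defs uses x ∧ y ≡ x.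
  private
    module Lib = IsOrderTheoreticLattice (LatticeProperties.∨-∧-isOrderTheoreticLattice lattice)

  ≤-refl : ∀ {x} → x ≤ x
  ≤-refl = sym Lib.refl

  ≤-reflexive : ∀ {x y} → x ≡ y → x ≤ y
  ≤-reflexive refl = ≤-refl

  ≤-trans : ∀ {x y z} → x ≤ y → y ≤ z → x ≤ z
  ≤-trans p q = sym (Lib.trans (sym p) (sym q))

  ≤-antisym : ∀ {x y} → x ≤ y → y ≤ x → x ≡ y
  ≤-antisym p q = Lib.antisym (sym p) (sym q)

  x≤x∨y : ∀ x y → x ≤ x ∨ y
  x≤x∨y x y = sym (Lib.x≤x∨y x y)

  y≤x∨y : ∀ x y → y ≤ x ∨ y
  y≤x∨y x y = sym (Lib.y≤x∨y x y)

  ∨-least : ∀ {x y z} → x ≤ z → y ≤ z → x ∨ y ≤ z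
  ∨-least p q = sym (Lib.∨-least (sym p) (sym q))

  ∨-monoˡ-≤ : ∀ {x y} z → x ≤ y → x ∨ z ≤ y ∨ z
  ∨-monoˡ-≤ {x} {y} z x≤y = ∨-least (≤-trans x≤y (x≤x∨y y z)) (y≤x∨y y z)

  𝟙≤⇒≡𝟙 : ∀ {x} → 𝟙 ≤ x → x ≡ 𝟙
  𝟙≤⇒≡𝟙 {x} 𝟙≤x = ≤-antisym (𝟙-greatest x) 𝟙≤x

  ⊙-monoʳ-≤ : ∀ {x y} z → x ≤ y → z ⊙ x ≤ z ⊙ y
  ⊙-monoʳ-≤ {y = y} z x≤y =
    from (residuation z _ _) (≤-trans x≤y (to (residuation z (z ⊙ y) y) ≤-refl))

  ⊙-monoˡ-≤ : ∀ {x y} z → x ≤ y → x ⊙ z ≤ y ⊙ z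
  ⊙-monoˡ-≤ {x} {y} z x≤y = subst₂ _≤_ (⊙-comm z x) (⊙-comm z y) (⊙-monoʳ-≤ z x≤y)

  ⊙-mono-≤ : ∀ {x y u v} → x ≤ y → u ≤ v → x ⊙ u ≤ y ⊙ v
  ⊙-mono-≤ {y = y} {u} x≤y u≤v = ≤-trans (⊙-monoˡ-≤ u x≤y) (⊙-monoʳ-≤ y u≤v)

  x⊙y≤y : ∀ x y → x ⊙ y ≤ y
  x⊙y≤y x y = ≤-trans (⊙-monoˡ-≤ y (𝟙-greatest x)) (≤-reflexive (⊙-identityˡ y))

  x⊙y≤x : ∀ x y → x ⊙ y ≤ x
  x⊙y≤x x y = subst (_≤ x) (⊙-comm y x) (x⊙y≤y y x)

  ⊙-∨-least : ∀ {a x y z} → a ⊙ x ≤ z → a ⊙ y ≤ z → a ⊙ (x ∨ y) ≤ z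
  ⊙-∨-least {a} {z = z} p q =
    from (residuation a z _) (∨-least (to (residuation a z _) p) (to (residuation a z _) q))

  ∨-⊙-least : ∀ {a x y z} → x ⊙ a ≤ z → y ⊙ a ≤ z → (x ∨ y) ⊙ a ≤ z
  ∨-⊙-least {a} {x} {y} p q =
    subst (_≤ _) (⊙-comm a (x ∨ y))
      (⊙-∨-least (subst (_≤ _) (⊙-comm x a) p) (subst (_≤ _) (⊙-comm y a) q))

  ∨⊙∨≤⊙∨ : ∀ x y z → (x ∨ z) ⊙ (y ∨ z) ≤ x ⊙ y ∨ z
  ∨⊙∨≤⊙∨ x y z = ⊙-∨-least
    (∨-⊙-least (x≤x∨y (x ⊙ y) z) (≤-trans (x⊙y≤x z y) (y≤x∨y (x ⊙ y) z)))
    (≤-trans (x⊙y≤y (x ∨ z) z) (y≤x∨y (x ⊙ y) z))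

module FilterProperties (L : ResiduatedLattice) where
  open ResiduatedLattice L
  open ResiduatedLatticeProperties L
  open IsFilter

  filter-𝟙 : ∀ {F} → IsFilter L F → F 𝟙
  filter-𝟙 F-filter = up-closed F-filter (proj₂ (nonempty F-filter)) (𝟙-greatest _)

  filter-· : ∀ {F x} → IsFilter L F → F x → ∀ n → F (n · x)
  filter-· F-filter x∈F zero = filter-𝟙 F-filter
  filter-· F-filter x∈F (suc n) = ⊙-closed F-filter x∈F (filter-· F-filter x∈F n)

  ｛𝟙｝-isFilter : IsFilter L ｛ 𝟙 ｝
  ｛𝟙｝-isFilter = record
    { nonempty = 𝟙 , refl
    ; ⊙-closed = λ { refl refl → sym (⊙-identityˡ 𝟙) }
    ; up-closed = λ { refl 𝟙≤y → sym (𝟙≤⇒≡𝟙 𝟙≤y) }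
    }

  ∨-preimage : Subset L → Carrier → Subset L
  ∨-preimage F y z = F (z ∨ y)

  ⊆-∨-preimage : ∀ {F} y → IsFilter L F → F ⊆ ∨-preimage F y
  ⊆-∨-preimage y F-filter {z} z∈F = up-closed F-filter z∈F (x≤x∨y z y)

  ∨-preimage-isFilter : ∀ {F} y → IsFilter L F → IsFilter L (∨-preimage F y)
  ∨-preimage-isFilter y F-filter = record
    { nonempty = 𝟙 , ⊆-∨-preimage y F-filter (filter-𝟙 F-filter)
    ; ⊙-closed = λ p q → up-closed F-filter (⊙-closed F-filter p q) (∨⊙∨≤⊙∨ _ _ y)
    ; up-closed = λ p x≤z → up-closed F-filter p (∨-monoˡ-≤ y x≤z)
    }

  adjoin : Subset L → Carrier → Subset L
  adjoin F x z = ∃ λ f → F f × ∃ λ n → f ⊙ n · x ≤ z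

  adjoin-isFilter : ∀ {F} x → IsFilter L F → IsFilter L (adjoin F x)
  adjoin-isFilter x F-filter = record
    { nonempty = 𝟙 ⊙ 0 · x , 𝟙 , filter-𝟙 F-filter , 0 , ≤-refl
    ; ⊙-closed = λ { (f , f∈F , m , p) (g , g∈F , n , q) →
        f ⊙ g , ⊙-closed F-filter f∈F g∈F , m + n ,
        ≤-trans (≤-reflexive (trans (cong ((f ⊙ g) ⊙_) (×-homo-+ x m n)) (interchange f g _ _)))
                (⊙-mono-≤ p q) }
    ; up-closed = λ { (f , f∈F , n , p) y≤z → f , f∈F , n , ≤-trans p y≤z }
    }

  ⊆-adjoin : ∀ {F} x → F ⊆ adjoin F x
  ⊆-adjoin x {z} z∈F = z , z∈F , 0 , ≤-reflexive (⊙-identityʳ z)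

  adjoin-∋ : ∀ {F} x → IsFilter L F → adjoin F x x
  adjoin-∋ x F-filter = 𝟙 , filter-𝟙 F-filter , 1 , ≤-reflexive (trans (⊙-identityˡ _) (×-homo-1 x))

  adjoin-least : ∀ {F K x} → IsFilter L K → F ⊆ K → K x → adjoin F x ⊆ K
  adjoin-least K-filter F⊆K x∈K (f , f∈F , n , f⊙xⁿ≤z) =
    up-closed K-filter (⊙-closed K-filter (F⊆K f∈F) (filter-· K-filter x∈K n)) f⊙xⁿ≤z

  -- {w | w ∨ y ∈ F} is a filter containing F and x, hence adjoin F x; so z ∨ y ∈ F.
  -- Then {w | w ∨ z ∈ F} contains F and y, hence adjoin F y, so z ∨ z ∈ F.
  adjoin-∩-⊆ : ∀ {F x y} → IsFilter L F → F (x ∨ y) → adjoin F x ∩ adjoin F y ⊆ F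
  adjoin-∩-⊆ {F} {x} {y} F-filter x∨y∈F {z} (z∈F+x , z∈F+y) = subst F (∨-idem z) z∨z∈F
    where
    z∨y∈F : F (z ∨ y)
    z∨y∈F = adjoin-least (∨-preimage-isFilter y F-filter) (⊆-∨-preimage y F-filter) x∨y∈F z∈F+x
    z∨z∈F : F (z ∨ z)
    z∨z∈F = adjoin-least (∨-preimage-isFilter z F-filter) (⊆-∨-preimage z F-filter)
              (subst F (∨-comm z y) z∨y∈F) z∈F+y

  product : List Carrier → Carrier
  product = foldr _⊙_ 𝟙

  filter-product : ∀ {F} → IsFilter L F → ∀ xs → (∀ {x} → x ∈ xs → F x) → F (product xs)
  filter-product F-filter [] xs⊆F = filter-𝟙 F-filter
  filter-product F-filter (x ∷ xs) xs⊆F =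
    ⊙-closed F-filter (xs⊆F (here refl)) (filter-product F-filter xs (xs⊆F ∘ there))

  product≤∈ : ∀ {x} xs → x ∈ xs → product xs ≤ x
  product≤∈ (x ∷ xs) (here refl) = x⊙y≤x x (product xs)
  product≤∈ (y ∷ xs) (there x∈xs) = ≤-trans (x⊙y≤y y (product xs)) (product≤∈ xs x∈xs)

  finitelyGenerated⇒principal : ∀ {P} → FinitelyGenerated L P →
    ∃ λ a → P a × (∀ {K} → IsFilter L K → K a → P ⊆ K)
  finitelyGenerated⇒principal (xs , P-filter , xs⊆P , P-least) =
    product xs , filter-product P-filter xs xs⊆P ,
    λ K-filter a∈K → P-least _ K-filter (λ x∈xs → up-closed K-filter a∈K (product≤∈ xs x∈xs))

zorn-preorder : ZornsLemma → {X : Set₁} (_≲_ : X → X → Set) → Reflexive _≲_ → Transitive _≲_ →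
  (∀ (C : Pred X 0ℓ) → (∀ {a b} → C a → C b → a ≲ b ⊎ b ≲ a) → ∃ λ u → ∀ {a} → C a → a ≲ u) →
  ∃ λ m → ∀ a → m ≲ a → a ≲ m
zorn-preorder zorn {X} _≲_ ≲-refl ≲-trans = zorn record
  { Carrier = X
  ; _≈_ = λ a b → a ≲ b × b ≲ a
  ; _≤_ = _≲_
  ; isPartialOrder = record
    { isPreorder = record
      { isEquivalence = record
        { refl = ≲-refl , ≲-refl
        ; sym = Product.swap
        ; trans = Product.zip ≲-trans (flip ≲-trans)
        }
      ; reflexive = proj₁
      ; trans = ≲-trans
      }
    ; antisym = _,_
    }
  }

module Classical (em : ExcludedMiddle (lsuc 0ℓ)) where

  dec : (P : Set) → Dec P
  dec P = map′ lower lift em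

  dne₀ : {P : Set} → ¬ ¬ P → P
  dne₀ = decidable-stable (dec _)

  dne : {P : Set₁} → ¬ ¬ P → P
  dne = em⇒dne em

  ⊈⇒∃∖ : {A : Set} {P Q : Pred A 0ℓ} → ¬ P ⊆ Q → ∃ λ x → P x × ¬ Q x
  ⊈⇒∃∖ P⊈Q = dne₀ λ none → P⊈Q λ {x} x∈P → dne₀ λ x∉Q → none (x , x∈P , x∉Q)

  -- Excluded middle lets a large proposition be replaced by a small one, so that
  -- unions and intersections of large families of subsets are again subsets.
  Resize : Set₁ → Set
  Resize P = True (em {P})

  resize : {P : Set₁} → P → Resize P
  resize = fromWitness

  unresize : {P : Set₁} → Resize P → P
  unresize {P} = toWitness {a? = em {P}}

  module _ (L : ResiduatedLattice) where
    open ResiduatedLattice L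
    open ResiduatedLatticeProperties L
    open FilterProperties L
    open IsFilter
    open IsPrime

    Chain : {I : Set₁} → (I → Subset L) → Set₁
    Chain F = ∀ i j → F i ⊆ F j ⊎ F j ⊆ F i

    ⋃ : {I : Set₁} → (I → Subset L) → Subset L
    ⋃ F z = Resize (∃ λ i → F i z)

    ⋂ : {I : Set₁} → (I → Subset L) → Subset L
    ⋂ F z = Resize (∀ i → F i z)

    ⋃-isFilter : ∀ {I} {F : I → Subset L} → I → (∀ i → IsFilter L (F i)) → Chain F →
                 IsFilter L (⋃ F)
    ⋃-isFilter {F = F} i₀ F-filter F-chain = record
      { nonempty = 𝟙 , resize (i₀ , filter-𝟙 (F-filter i₀))
      ; ⊙-closed = λ x∈⋃ y∈⋃ → resize (⊙-closed-⋃ (unresize x∈⋃) (unresize y∈⋃))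
      ; up-closed = λ x∈⋃ x≤y →
          let i , x∈Fi = unresize x∈⋃ in resize (i , up-closed (F-filter i) x∈Fi x≤y)
      }
      where
      ⊙-closed-⋃ : ∀ {x y} → (∃ λ i → F i x) → (∃ λ j → F j y) → ∃ λ k → F k (x ⊙ y)
      ⊙-closed-⋃ (i , x∈Fi) (j , y∈Fj) with F-chain i j
      ... | inj₁ Fi⊆Fj = j , ⊙-closed (F-filter j) (Fi⊆Fj x∈Fi) y∈Fj
      ... | inj₂ Fj⊆Fi = i , ⊙-closed (F-filter i) x∈Fi (Fj⊆Fi y∈Fj)

    ⋂-isFilter : ∀ {I} {F : I → Subset L} → (∀ i → IsFilter L (F i)) → IsFilter L (⋂ F)
    ⋂-isFilter F-filter = record
      { nonempty = 𝟙 , resize (λ i → filter-𝟙 (F-filter i))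
      ; ⊙-closed = λ x∈⋂ y∈⋂ → resize λ i → ⊙-closed (F-filter i) (unresize x∈⋂ i) (unresize y∈⋂ i)
      ; up-closed = λ x∈⋂ x≤y → resize λ i → up-closed (F-filter i) (unresize x∈⋂ i) x≤y
      }

    ⋂-isPrime : ∀ {I} {F : I → Subset L} → I → (∀ i → IsPrime L (F i)) → Chain F → IsPrime L (⋂ F)
    ⋂-isPrime {F = F} i₀ F-prime F-chain = record
      { filter = ⋂-isFilter (filter ∘ F-prime)
      ; proper = λ ⋂-full → proper (F-prime i₀) (λ z → unresize (⋂-full z) i₀)
      ; prime = Sum.map resize resize ∘ prime-⋂ ∘ unresize
      }
      where
      prime-⋂ : ∀ {x y} → (∀ i → F i (x ∨ y)) → (∀ i → F i x) ⊎ (∀ i → F i y)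
      prime-⋂ {x} {y} x∨y∈F with em {∀ i → F i x}
      ... | yes x∈F = inj₁ x∈F
      ... | no x∉F = inj₂ y∈F
        where
        -- a member i missing x lies below every member containing x, and contains y
        missing : ∃ λ i → ¬ F i x
        missing = dne λ none → x∉F λ i → dne₀ λ x∉Fi → none (i , x∉Fi)
        y∈F : ∀ j → F j y
        y∈F j with prime (F-prime j) (x∨y∈F j) | missing
        ... | inj₂ y∈Fj | _ = y∈Fj
        ... | inj₁ x∈Fj | i , x∉Fi with F-chain i j
        ...   | inj₂ Fj⊆Fi = ⊥-elim (x∉Fi (Fj⊆Fi x∈Fj))
        ...   | inj₁ Fi⊆Fj = [ ⊥-elim ∘ x∉Fi , Fi⊆Fj ]′ (prime (F-prime i) (x∨y∈F i))

    -- Adding a base B comparable with all members makes a chain nonempty, which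
    -- covers the empty chain in the applications of Zorn's lemma below.
    module _ {X : Set₁} (set : X → Subset L) (C : Pred X 0ℓ) (B : Subset L) where

      withBase : Maybe (Σ X C) → Subset L
      withBase nothing = B
      withBase (just (a , _)) = set a

      withBase-chain : (∀ {a b} → C a → C b → set a ⊆ set b ⊎ set b ⊆ set a) →
                       (∀ {a} → C a → B ⊆ set a ⊎ set a ⊆ B) → Chain withBase
      withBase-chain C-chain B-comparable nothing nothing = inj₁ id
      withBase-chain C-chain B-comparable nothing (just (b , b∈C)) = B-comparable b∈C
      withBase-chain C-chain B-comparable (just (a , a∈C)) nothing = Sum.swap (B-comparable a∈C)
      withBase-chain C-chain B-comparable (just (a , a∈C)) (just (b , b∈C)) = C-chain a∈C b∈C

    JoinClosed : Subset L → Set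
    JoinClosed S = ∀ {x y} → S x → S y → S (x ∨ y)

    adjoin-meets⇒prime : ∀ {M S} → IsFilter L M → JoinClosed S → Satisfiable S → ¬ (M ≬ S) →
                         (∀ {x} → ¬ M x → adjoin M x ≬ S) → IsPrime L M
    adjoin-meets⇒prime {M} {S} M-filter S-closed (s , s∈S) M∩S-empty adjoin-meets = record
      { filter = M-filter
      ; proper = λ M-full → M∩S-empty (s , M-full s , s∈S)
      ; prime = M-prime
      }
      where
      M-prime : ∀ {x y} → M (x ∨ y) → M x ⊎ M y
      M-prime {x} {y} x∨y∈M with dec (M x) | dec (M y)
      ... | yes x∈M | _ = inj₁ x∈M
      ... | no _ | yes y∈M = inj₂ y∈M
      ... | no x∉M | no y∉M with adjoin-meets x∉M | adjoin-meets y∉M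
      ... | s₁ , s₁∈M+x , s₁∈S | s₂ , s₂∈M+y , s₂∈S =
        ⊥-elim (M∩S-empty (s₁ ∨ s₂ , s₁∨s₂∈M , S-closed s₁∈S s₂∈S))
        where
        s₁∨s₂∈M : M (s₁ ∨ s₂)
        s₁∨s₂∈M = adjoin-∩-⊆ M-filter x∨y∈M
          ( up-closed (adjoin-isFilter x M-filter) s₁∈M+x (x≤x∨y s₁ s₂)
          , up-closed (adjoin-isFilter y M-filter) s₂∈M+y (y≤x∨y s₁ s₂))

    module _ (zorn : ZornsLemma) where

      primeFilterTheorem : ∀ {G S} → IsFilter L G → JoinClosed S → Satisfiable S → ¬ (G ≬ S) →
                           ∃ λ Q → IsPrime L Q × G ⊆ Q × ¬ (Q ≬ S)
      primeFilterTheorem {G} {S} G-filter S-closed S-nonempty G∩S-empty = prime-of-maximal maximal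
        where
        Candidate : Set₁
        Candidate = Σ (Subset L) λ M → IsFilter L M × G ⊆ M × ¬ (M ≬ S)

        _⊑_ : Candidate → Candidate → Set
        a ⊑ b = proj₁ a ⊆ proj₁ b

        chain-bounded : ∀ (C : Pred Candidate 0ℓ) → (∀ {a b} → C a → C b → a ⊑ b ⊎ b ⊑ a) →
                        ∃ λ u → ∀ {a} → C a → a ⊑ u
        chain-bounded C C-chain =
          (U , U-filter , (λ {_} → G⊆U) , U∩S-empty) , λ a∈C z∈a → resize (just (_ , a∈C) , z∈a)
          where
          U : Subset L
          U = ⋃ (withBase proj₁ C G)
          U-filter : IsFilter L U
          U-filter = ⋃-isFilter nothing
            (λ { nothing → G-filter ; (just ((_ , a-filter , _) , _)) → a-filter })
            (withBase-chain proj₁ C G C-chain (λ { {_ , _ , G⊆a , _} _ → inj₁ G⊆a }))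
          G⊆U : G ⊆ U
          G⊆U z∈G = resize (nothing , z∈G)
          U∩S-empty : ¬ (U ≬ S)
          U∩S-empty (z , z∈U , z∈S) with unresize z∈U
          ... | nothing , z∈G = G∩S-empty (z , z∈G , z∈S)
          ... | just ((_ , _ , _ , a∩S-empty) , _) , z∈a = a∩S-empty (z , z∈a , z∈S)

        maximal : ∃ λ m → ∀ a → m ⊑ a → a ⊑ m
        maximal = zorn-preorder zorn _⊑_ id (λ a⊑b b⊑c → b⊑c ∘ a⊑b) chain-bounded

        prime-of-maximal : (∃ λ m → ∀ a → m ⊑ a → a ⊑ m) → ∃ λ Q → IsPrime L Q × G ⊆ Q × ¬ (Q ≬ S)
        prime-of-maximal ((M , M-filter , G⊆M , M∩S-empty) , M-maximal) =
          M , adjoin-meets⇒prime M-filter S-closed S-nonempty M∩S-empty adjoin-meets ,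
          G⊆M , M∩S-empty
          where
          adjoin-meets : ∀ {x} → ¬ M x → adjoin M x ≬ S
          adjoin-meets {x} x∉M = dne₀ λ M+x∩S-empty →
            let M+x : Candidate
                M+x = adjoin M x , adjoin-isFilter x M-filter , ⊆-adjoin x ∘ G⊆M , M+x∩S-empty
            in x∉M (M-maximal M+x (⊆-adjoin x) (adjoin-∋ x M-filter))

      minimalPrimeBelow : ∀ {P} → IsPrime L P → ∃ λ Q → IsMinimalPrime L Q × Q ⊆ P
      minimalPrimeBelow {P} P-prime = minimalPrime-of-minimal minimal
        where
        Candidate : Set₁
        Candidate = Σ (Subset L) λ Q → IsPrime L Q × Q ⊆ P

        _⊒_ : Candidate → Candidate → Set
        a ⊒ b = proj₁ b ⊆ proj₁ a

        chain-bounded : ∀ (C : Pred Candidate 0ℓ) → (∀ {a b} → C a → C b → a ⊒ b ⊎ b ⊒ a) →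
                        ∃ λ u → ∀ {a} → C a → a ⊒ u
        chain-bounded C C-chain =
          (I , I-prime , (λ {_} → I⊆P)) , λ a∈C z∈I → unresize z∈I (just (_ , a∈C))
          where
          I : Subset L
          I = ⋂ (withBase proj₁ C P)
          I-prime : IsPrime L I
          I-prime = ⋂-isPrime nothing
            (λ { nothing → P-prime ; (just ((_ , a-prime , _) , _)) → a-prime })
            (withBase-chain proj₁ C P (λ a∈C b∈C → Sum.swap (C-chain a∈C b∈C))
                            (λ { {_ , _ , a⊆P} _ → inj₂ a⊆P }))
          I⊆P : I ⊆ P
          I⊆P z∈I = unresize z∈I nothing

        minimal : ∃ λ m → ∀ a → m ⊒ a → a ⊒ m
        minimal = zorn-preorder zorn _⊒_ id (λ a⊒b b⊒c → a⊒b ∘ b⊒c) chain-bounded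

        minimalPrime-of-minimal : (∃ λ m → ∀ a → m ⊒ a → a ⊒ m) → ∃ λ Q → IsMinimalPrime L Q × Q ⊆ P
        minimalPrime-of-minimal ((Q , Q-prime , Q⊆P) , Q-minimal) =
          Q , (Q-prime , Q-minimal′) , Q⊆P
          where
          Q-minimal′ : ¬ (Σ (Subset L) λ R → IsPrime L R × R ⊆ Q × ¬ (Q ⊆ R))
          Q-minimal′ (R , R-prime , R⊆Q , Q⊈R) = Q⊈R (Q-minimal (R , R-prime , Q⊆P ∘ R⊆Q) R⊆Q)

      -- Otherwise S = {z | z ≤ s ∨ x for some s ∉ P} avoids 𝟙, and a prime filter
      -- avoiding S lies inside P but misses x ∈ S, contradicting minimality.
      minimalPrime-∨-complement : ∀ {P x} → IsMinimalPrime L P → P x → ∃ λ y → ¬ P y × x ∨ y ≡ 𝟙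
      minimalPrime-∨-complement {P} {x} (P-prime , P-minimal) x∈P = dne₀ λ no-complement →
        let Q , Q-prime , _ , Q∩S-empty =
              primeFilterTheorem ｛𝟙｝-isFilter S-closed (x , x∈S) (𝟙∉S no-complement)
            Q⊆P : Q ⊆ P
            Q⊆P {z} z∈Q = dne₀ λ z∉P → Q∩S-empty (z , z∈Q , z , z∉P , x≤x∨y z x)
        in P-minimal (Q , Q-prime , Q⊆P , λ P⊆Q → Q∩S-empty (x , P⊆Q x∈P , x∈S))
        where
        S : Subset L
        S z = ∃ λ s → ¬ P s × z ≤ s ∨ x

        S-closed : JoinClosed S
        S-closed (s₁ , s₁∉P , z₁≤s₁∨x) (s₂ , s₂∉P , z₂≤s₂∨x) =
          s₁ ∨ s₂ , [ s₁∉P , s₂∉P ]′ ∘ prime P-prime ,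
          ∨-least (≤-trans z₁≤s₁∨x (∨-monoˡ-≤ x (x≤x∨y s₁ s₂)))
                  (≤-trans z₂≤s₂∨x (∨-monoˡ-≤ x (y≤x∨y s₁ s₂)))

        x∈S : S x
        x∈S = 𝟘 , (λ 𝟘∈P → proper P-prime λ z → up-closed (filter P-prime) 𝟘∈P (𝟘-least z)) ,
              y≤x∨y 𝟘 x

        𝟙∉S : ¬ (∃ λ y → ¬ P y × x ∨ y ≡ 𝟙) → ¬ (｛ 𝟙 ｝ ≬ S)
        𝟙∉S no-complement (_ , refl , s , s∉P , 𝟙≤s∨x) =
          no-complement (s , s∉P , trans (∨-comm x s) (𝟙≤⇒≡𝟙 𝟙≤s∨x))

      minimalPrime-∌ : ∀ {x} → x ≢ 𝟙 → ∃ λ P → IsMinimalPrime L P × ¬ P x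
      minimalPrime-∌ {x} x≢𝟙 =
        let P , P-prime , _ , P∩x-empty =
              primeFilterTheorem {S = ｛ x ｝} ｛𝟙｝-isFilter (λ { refl refl → sym (∨-idem x) })
                (x , refl) (λ { (_ , refl , x≡𝟙) → x≢𝟙 x≡𝟙 })
            Q , Q-minimal , Q⊆P = minimalPrimeBelow P-prime
        in Q , Q-minimal , λ x∈Q → P∩x-empty (x , Q⊆P x∈Q , refl)

      -- For z ∈ F ⊆ P with z ∨ a = 𝟙, the filter {w | w ∨ z = 𝟙} contains a, hence P,
      -- hence z itself, so z = z ∨ z = 𝟙.
      essential⇒⊈minimalPrime : ∀ {F P} → IsFilter L F → IsEssential L F →
                                IsMinimalPrime L P → FinitelyGenerated L P → ¬ F ⊆ P
      essential⇒⊈minimalPrime {F} {P} F-filter F-essential P-minimal@(P-prime , _) P-fg F⊆P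
        with finitelyGenerated⇒principal P-fg
      ... | a , a∈P , P-least with minimalPrime-∨-complement P-minimal a∈P
      ... | b , b∉P , a∨b≡𝟙 = b∉P (subst P (sym b≡𝟙) (filter-𝟙 (filter P-prime)))
        where
        a⊥ : Subset L
        a⊥ = ∨-preimage ｛ 𝟙 ｝ a

        F∩a⊥≡𝟙 : ∀ z → (F z × a⊥ z) ⇔ (z ≡ 𝟙)
        F∩a⊥≡𝟙 z = mk⇔
          (λ (z∈F , 𝟙≡z∨a) → sym (trans (P-least (∨-preimage-isFilter z ｛𝟙｝-isFilter)
                                                 (trans 𝟙≡z∨a (∨-comm z a)) (F⊆P z∈F))
                                          (∨-idem z)))
          (λ { refl → filter-𝟙 F-filter , sym (𝟙≤⇒≡𝟙 (x≤x∨y 𝟙 a)) })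

        b≡𝟙 : b ≡ 𝟙
        b≡𝟙 = Equivalence.to (F-essential a⊥ (∨-preimage-isFilter a ｛𝟙｝-isFilter) F∩a⊥≡𝟙 b)
                             (trans (sym a∨b≡𝟙) (∨-comm a b))

      ⊈minimalPrimes⇒essential : ∀ {F} → IsFilter L F → (∀ P → IsMinimalPrime L P → ¬ F ⊆ P) →
                                 IsEssential L F
      ⊈minimalPrimes⇒essential {F} F-filter F⊈minimal G G-filter F∩G≡𝟙 g =
        mk⇔ (λ g∈G → dne₀ (g∈G-trivial g∈G)) (λ { refl → filter-𝟙 G-filter })
        where
        g∈G-trivial : G g → ¬ g ≢ 𝟙
        g∈G-trivial g∈G g≢𝟙 =
          let P , (P-prime , P-minimal) , g∉P = minimalPrime-∌ g≢𝟙
              x , x∈F , x∉P = ⊈⇒∃∖ (F⊈minimal P (P-prime , P-minimal))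
              x∨g≡𝟙 : x ∨ g ≡ 𝟙
              x∨g≡𝟙 = Equivalence.to (F∩G≡𝟙 (x ∨ g))
                        (up-closed F-filter x∈F (x≤x∨y x g) , up-closed G-filter g∈G (y≤x∨y x g))
          in [ x∉P , g∉P ]′ (prime P-prime (subst P (sym x∨g≡𝟙) (filter-𝟙 (filter P-prime))))

theorem2p25 : ExcludedMiddle (lsuc 0ℓ) → ZornsLemma →
    (L : ResiduatedLattice) →
    (∀ P → IsMinimalPrime L P → FinitelyGenerated L P) →
    ∀ F → IsFilter L F →
    IsEssential L F ⇔ (∀ P → IsMinimalPrime L P → ¬ (F ⊆ P))
theorem2p25 em zorn L minimal-fg F F-filter = mk⇔
  (λ F-essential P P-minimal →
     essential⇒⊈minimalPrime L zorn F-filter F-essential P-minimal (minimal-fg P P-minimal))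
  (⊈minimalPrimes⇒essential L zorn F-filter)
  where
  open Classical em
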